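{- Let $t$ be a closed proof-term of the $\odot$-calculus which is irreducible (has no one-step reduct) and such that $\vdash t : A$ (empty context). Then: if $A=\top$, then $t = *$; $A$ is not $\bot$; if $A = B\Rightarrow C$, then $t$ has the form $\lambda x\,u$; if $A = B\wedge C$, then $t$ has the form $\langle u,v\rangle$; if $A = B\vee C$, then $t$ has the form $\mathrm{inl}(u)$, $\mathrm{inr}(u)$, or $u\parallel v$; if $A = B\odot C$, then $t$ has the form $u+v$.
   Context: The $\odot$-calculus. Propositions: $A ::= \top \mid \bot \mid A \Rightarrow A \mid A \wedge A \mid A \vee A \mid A \odot A$. Proof-terms: $t ::= x \mid t \parallel u \mid * \mid \delta_\bot(t) \mid \lambda x\, t \mid t\,u \mid \langle t,u\rangle \mid \delta_\wedge(t,[x,y]u) \mid \mathrm{inl}(t) \mid \mathrm{inr}(t) \mid \delta_\vee(t,[x]u,[y]v) \mid t+u \mid \delta_\odot(t,[x]u,[y]v) \mid \delta_\odot^\parallel(t,[x]u,[y]v)$, where $\lambda x$ binds $x$, $[x,y]$ binds $x,y$, and $[x]$, $[y]$ bind $x$, $y$; a term is closed if it has no free variables; $(u/x)t$ is capture-avoiding substitution. Typing rules: $\Gamma\vdash x:A$ if $x:A\in\Gamma$; from $\Gamma\vdash t:A$ and $\Gamma\vdash u:A$ infer $\Gamma\vdash t\parallel u:A$; $\Gamma\vdash *:\top$; from $\Gamma\vdash t:\bot$ infer $\Gamma\vdash\delta_\bot(t):C$; from $\Gamma,x:A\vdash t:B$ infer $\Gamma\vdash\lambda x\,t:A\Rightarrow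 B$; from $\Gamma\vdash t:A\Rightarrow B$ and $\Gamma\vdash u:A$ infer $\Gamma\vdash t\,u:B$; from $\Gamma\vdash t:A$, $\Gamma\vdash u:B$ infer $\Gamma\vdash\langle t,u\rangle:A\wedge B$; from $\Gamma\vdash t:A\wedge B$ and $\Gamma,x:A,y:B\vdash u:C$ infer $\Gamma\vdash\delta_\wedge(t,[x,y]u):C$; from $\Gamma\vdash t:A$ infer $\Gamma\vdash\mathrm{inl}(t):A\vee B$; from $\Gamma\vdash t:B$ infer $\Gamma\vdash\mathrm{inr}(t):A\vee B$; from $\Gamma\vdash t:A\vee B$, $\Gamma,x:A\vdash u:C$, $\Gamma,y:B\vdash v:C$ infer $\Gamma\vdash\delta_\vee(t,[x]u,[y]v):C$; from $\Gamma\vdash t:A$, $\Gamma\vdash u:B$ infer $\Gamma\vdash t+u:A\odot B$; from $\Gamma\vdash t:A\odot B$, $\Gamma,x:A\vdash u:C$, $\Gamma,y:B\vdash v:C$ infer both $\Gamma\vdash\delta_\odot(t,[x]u,[y]v):C$ and $\Gamma\vdash\delta_\odot^\parallel(t,[x]u,[y]v):C$. Reduction rules: $(\lambda x\,t)\,u\to(u/x)t$; $\delta_\wedge(\langle t,u\rangle,[x,y]v)\to(t/x,u/y)v$; $\delta_\vee(\mathrm{inl}(t),[x]v,[y]w)\to(t/x)v$; $\delta_\vee(\mathrm{inr}(u),[x]v,[y]w)\to(u/y)w$; $\delta_\odot(t+u,[x]v,[y]w)\to(t/x)v$; $\delta_\odot(t+u,[x]v,[y]w)\to(u/y)w$; $\delta_\odot^\parallel(t+u,[x]v,[y]w)\to(t/x)v\parallel(u/y)w$;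 $(\lambda x\,t)\parallel(\lambda x\,u)\to\lambda x\,(t\parallel u)$; $\langle t,u\rangle\parallel\langle v,w\rangle\to\langle t\parallel v,u\parallel w\rangle$; $\delta_\vee(t\parallel u,[x]v,[y]w)\to\delta_\vee(t,[x]v,[y]w)\parallel\delta_\vee(u,[x]v,[y]w)$; $(t+u)\parallel(v+w)\to(t\parallel v)+(u\parallel w)$; $t\parallel t\to t$. The reduction relation $\longrightarrow$ is the smallest contextual relation containing $\sigma l\to\sigma r$ for every rule $l\to r$ and substitution $\sigma$; a term is irreducible if it has no one-step reduct. -}

module Defs where

open import Data.Nat using (ℕ; zero; suc)
open import Data.Fin using (Fin; zero; suc)
open import Data.Vec using (Vec; []; _∷_; lookup)
open import Relation.Binary.PropositionalEquality using (_≡_)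
open import Relation.Nullary using (¬_)

infixr 5 _⇒_
infixr 6 _∨_ _⊙_
infixr 7 _∧_
data Form : Set where
  ⊤ᶠ  : Form
  ⊥ᶠ  : Form
  _⇒_ : Form → Form → Form
  _∧_ : Form → Form → Form
  _∨_ : Form → Form → Form
  _⊙_ : Form → Form → Form

-- Closed terms are exactly the elements of Term 0.
-- Binders: lam, and the branches of δ∨, δ⊙, δ⊙∥ bind one variable;
-- δ∧ binds two (x then y; index 0 = y, index 1 = x).
infixl 6 _∥_
data Term (n : ℕ) : Set where
  var  : Fin n → Term n
  _∥_  : Term n → Term n → Term n
  star : Term n
  δ⊥   : Term n → Term n
  lam  : Term (suc n) → Term n
  app  : Term n → Term n → Term n
  pair : Term n → Term n → Term n
  δ∧   : Term n → Term (suc (suc n)) → Term n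
  inl  : Term n → Term n
  inr  : Term n → Term n
  δ∨   : Term n → Term (suc n) → Term (suc n) → Term n
  plus : Term n → Term n → Term n
  δ⊙   : Term n → Term (suc n) → Term (suc n) → Term n
  δ⊙∥  : Term n → Term (suc n) → Term (suc n) → Term n

Closed : Set
Closed = Term 0

Ren : ℕ → ℕ → Set
Ren m n = Fin m → Fin n

extR : ∀ {m n} → Ren m n → Ren (suc m) (suc n)
extR ρ zero = zero
extR ρ (suc i) = suc (ρ i)

ren : ∀ {m n} → Ren m n → Term m → Term n
ren ρ (var i) = var (ρ i)
ren ρ (t ∥ u) = ren ρ t ∥ ren ρ u
ren ρ star = star
ren ρ (δ⊥ t) = δ⊥ (ren ρ t)
ren ρ (lam t) = lam (ren (extR ρ) t)
ren ρ (app t u) = app (ren ρ t) (ren ρ u)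
ren ρ (pair t u) = pair (ren ρ t) (ren ρ u)
ren ρ (δ∧ t u) = δ∧ (ren ρ t) (ren (extR (extR ρ)) u)
ren ρ (inl t) = inl (ren ρ t)
ren ρ (inr t) = inr (ren ρ t)
ren ρ (δ∨ t u v) = δ∨ (ren ρ t) (ren (extR ρ) u) (ren (extR ρ) v)
ren ρ (plus t u) = plus (ren ρ t) (ren ρ u)
ren ρ (δ⊙ t u v) = δ⊙ (ren ρ t) (ren (extR ρ) u) (ren (extR ρ) v)
ren ρ (δ⊙∥ t u v) = δ⊙∥ (ren ρ t) (ren (extR ρ) u) (ren (extR ρ) v)

Sub : ℕ → ℕ → Set
Sub m n = Fin m → Term n

extS : ∀ {m n} → Sub m n → Sub (suc m) (suc n)
extS σ zero = var zero
extS σ (suc i) = ren suc (σ i)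

sub : ∀ {m n} → Sub m n → Term m → Term n
sub σ (var i) = σ i
sub σ (t ∥ u) = sub σ t ∥ sub σ u
sub σ star = star
sub σ (δ⊥ t) = δ⊥ (sub σ t)
sub σ (lam t) = lam (sub (extS σ) t)
sub σ (app t u) = app (sub σ t) (sub σ u)
sub σ (pair t u) = pair (sub σ t) (sub σ u)
sub σ (δ∧ t u) = δ∧ (sub σ t) (sub (extS (extS σ)) u)
sub σ (inl t) = inl (sub σ t)
sub σ (inr t) = inr (sub σ t)
sub σ (δ∨ t u v) = δ∨ (sub σ t) (sub (extS σ) u) (sub (extS σ) v)
sub σ (plus t u) = plus (sub σ t) (sub σ u)
sub σ (δ⊙ t u v) = δ⊙ (sub σ t) (sub (extS σ) u) (sub (extS σ) v)
sub σ (δ⊙∥ t u v) = δ⊙∥ (sub σ t) (sub (extS σ) u) (sub (extS σ) v)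

-- (u/x)t where x is the outermost-bound variable (index 0)
_[_] : ∀ {n} → Term (suc n) → Term n → Term n
_[_] {n} t u = sub σ t
  where
  σ : Sub (suc n) n
  σ zero = u
  σ (suc i) = var i

-- (t/x, u/y)v for v in scope x, y (index 1 = x, index 0 = y)
subst2 : ∀ {n} → Term (suc (suc n)) → Term n → Term n → Term n
subst2 {n} v t u = sub σ v
  where
  σ : Sub (suc (suc n)) n
  σ zero = u
  σ (suc zero) = t
  σ (suc (suc i)) = var i

-- Typing (contexts: index 0 is the most recently bound variable)
Ctx : ℕ → Set
Ctx n = Vec Form n

infix 3 _⊢_∶_
data _⊢_∶_ {n} (Γ : Ctx n) : Term n → Form → Set where
  ty-var  : ∀ {i A} → lookup Γ i ≡ A → Γ ⊢ var i ∶ A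
  ty-par  : ∀ {t u A} → Γ ⊢ t ∶ A → Γ ⊢ u ∶ A → Γ ⊢ t ∥ u ∶ A
  ty-star : Γ ⊢ star ∶ ⊤ᶠ
  ty-δ⊥   : ∀ {t C} → Γ ⊢ t ∶ ⊥ᶠ → Γ ⊢ δ⊥ t ∶ C
  ty-lam  : ∀ {t A B} → (A ∷ Γ) ⊢ t ∶ B → Γ ⊢ lam t ∶ A ⇒ B
  ty-app  : ∀ {t u A B} → Γ ⊢ t ∶ A ⇒ B → Γ ⊢ u ∶ A → Γ ⊢ app t u ∶ B
  ty-pair : ∀ {t u A B} → Γ ⊢ t ∶ A → Γ ⊢ u ∶ B → Γ ⊢ pair t u ∶ A ∧ B
  ty-δ∧   : ∀ {t u A B C} → Γ ⊢ t ∶ A ∧ B → (B ∷ A ∷ Γ) ⊢ u ∶ C → Γ ⊢ δ∧ t u ∶ C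
  ty-inl  : ∀ {t A B} → Γ ⊢ t ∶ A → Γ ⊢ inl t ∶ A ∨ B
  ty-inr  : ∀ {t A B} → Γ ⊢ t ∶ B → Γ ⊢ inr t ∶ A ∨ B
  ty-δ∨   : ∀ {t u v A B C} → Γ ⊢ t ∶ A ∨ B → (A ∷ Γ) ⊢ u ∶ C → (B ∷ Γ) ⊢ v ∶ C
          → Γ ⊢ δ∨ t u v ∶ C
  ty-plus : ∀ {t u A B} → Γ ⊢ t ∶ A → Γ ⊢ u ∶ B → Γ ⊢ plus t u ∶ A ⊙ B
  ty-δ⊙   : ∀ {t u v A B C} → Γ ⊢ t ∶ A ⊙ B → (A ∷ Γ) ⊢ u ∶ C → (B ∷ Γ) ⊢ v ∶ C
          → Γ ⊢ δ⊙ t u v ∶ C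
  ty-δ⊙∥  : ∀ {t u v A B C} → Γ ⊢ t ∶ A ⊙ B → (A ∷ Γ) ⊢ u ∶ C → (B ∷ Γ) ⊢ v ∶ C
          → Γ ⊢ δ⊙∥ t u v ∶ C

-- One-step reduction: the rules, closed under all term contexts.
-- (Instances σl → σr are covered since the metavariables range over all terms.)
infix 2 _⟶_
data _⟶_ {n} : Term n → Term n → Set where
  β⇒     : ∀ {t u} → app (lam t) u ⟶ t [ u ]
  β∧     : ∀ {t u v} → δ∧ (pair t u) v ⟶ subst2 v t u
  β∨l    : ∀ {t v w} → δ∨ (inl t) v w ⟶ v [ t ]
  β∨r    : ∀ {u v w} → δ∨ (inr u) v w ⟶ w [ u ]
  β⊙l    : ∀ {t u v w} → δ⊙ (plus t u) v w ⟶ v [ t ]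
  β⊙r    : ∀ {t u v w} → δ⊙ (plus t u) v w ⟶ w [ u ]
  β⊙∥    : ∀ {t u v w} → δ⊙∥ (plus t u) v w ⟶ (v [ t ]) ∥ (w [ u ])
  ∥lam   : ∀ {t u} → lam t ∥ lam u ⟶ lam (t ∥ u)
  ∥pair  : ∀ {t u v w} → pair t u ∥ pair v w ⟶ pair (t ∥ v) (u ∥ w)
  δ∨∥    : ∀ {t u v w} → δ∨ (t ∥ u) v w ⟶ δ∨ t v w ∥ δ∨ u v w
  ∥plus  : ∀ {t u v w} → plus t u ∥ plus v w ⟶ plus (t ∥ v) (u ∥ w)
  ∥idem  : ∀ {t} → t ∥ t ⟶ t
  c-∥₁   : ∀ {t t' u} → t ⟶ t' → t ∥ u ⟶ t' ∥ u
  c-∥₂   : ∀ {t u u'} → u ⟶ u' → t ∥ u ⟶ t ∥ u'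
  c-δ⊥   : ∀ {t t'} → t ⟶ t' → δ⊥ t ⟶ δ⊥ t'
  c-lam  : ∀ {t t'} → t ⟶ t' → lam t ⟶ lam t'
  c-app₁ : ∀ {t t' u} → t ⟶ t' → app t u ⟶ app t' u
  c-app₂ : ∀ {t u u'} → u ⟶ u' → app t u ⟶ app t u'
  c-pair₁ : ∀ {t t' u} → t ⟶ t' → pair t u ⟶ pair t' u
  c-pair₂ : ∀ {t u u'} → u ⟶ u' → pair t u ⟶ pair t u'
  c-δ∧₁  : ∀ {t t' u} → t ⟶ t' → δ∧ t u ⟶ δ∧ t' u
  c-δ∧₂  : ∀ {t u u'} → u ⟶ u' → δ∧ t u ⟶ δ∧ t u'
  c-inl  : ∀ {t t'} → t ⟶ t' → inl t ⟶ inl t'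
  c-inr  : ∀ {t t'} → t ⟶ t' → inr t ⟶ inr t'
  c-δ∨₁  : ∀ {t t' u v} → t ⟶ t' → δ∨ t u v ⟶ δ∨ t' u v
  c-δ∨₂  : ∀ {t u u' v} → u ⟶ u' → δ∨ t u v ⟶ δ∨ t u' v
  c-δ∨₃  : ∀ {t u v v'} → v ⟶ v' → δ∨ t u v ⟶ δ∨ t u v'
  c-plus₁ : ∀ {t t' u} → t ⟶ t' → plus t u ⟶ plus t' u
  c-plus₂ : ∀ {t u u'} → u ⟶ u' → plus t u ⟶ plus t u'
  c-δ⊙₁  : ∀ {t t' u v} → t ⟶ t' → δ⊙ t u v ⟶ δ⊙ t' u v
  c-δ⊙₂  : ∀ {t u u' v} → u ⟶ u' → δ⊙ t u v ⟶ δ⊙ t u' v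
  c-δ⊙₃  : ∀ {t u v v'} → v ⟶ v' → δ⊙ t u v ⟶ δ⊙ t u v'
  c-δ⊙∥₁ : ∀ {t t' u v} → t ⟶ t' → δ⊙∥ t u v ⟶ δ⊙∥ t' u v
  c-δ⊙∥₂ : ∀ {t u u' v} → u ⟶ u' → δ⊙∥ t u v ⟶ δ⊙∥ t u' v
  c-δ⊙∥₃ : ∀ {t u v v'} → v ⟶ v' → δ⊙∥ t u v ⟶ δ⊙∥ t u v'

Irreducible : ∀ {n} → Term n → Set
Irreducible t = ∀ t' → ¬ (t ⟶ t')

{-# OPTIONS --safe #-}
module Submission where

-- An elimination is never irreducible: its principal
-- argument is again closed and irreducible, hence an introduction (or, for
-- ∨, a parallel composition), and the elimination then β-reduces (or
-- commutes with ∥ via δ∨∥).  A parallel composition u ∥ v of two canonical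
-- terms reduces by ∥idem, ∥lam, ∥pair or ∥plus unless the type is a
-- disjunction, and ⊥ has no canonical inhabitant at all.

open import Defs
open import Data.Vec using ([])
open import Data.Product using (∃; ∃-syntax; _×_; _,_)
open import Data.Sum using (_⊎_; inj₁; inj₂)
open import Data.Empty using (⊥; ⊥-elim)
open import Relation.Binary.PropositionalEquality using (_≡_; _≢_; refl)

Canonical : Form → Closed → Set
Canonical ⊤ᶠ      t = t ≡ star
Canonical ⊥ᶠ      t = ⊥
Canonical (A ⇒ B) t = ∃[ u ] t ≡ lam u
Canonical (A ∧ B) t = ∃[ u ] ∃[ v ] t ≡ pair u v
Canonical (A ∨ B) t =
  (∃[ u ] t ≡ inl u) ⊎ (∃[ u ] t ≡ inr u) ⊎ (∃[ u ] ∃[ v ] t ≡ u ∥ v)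
Canonical (A ⊙ B) t = ∃[ u ] ∃[ v ] t ≡ plus u v

irreducible-inside : ∀ {m n} {C : Term m → Term n} →
  (∀ {t t'} → t ⟶ t' → C t ⟶ C t') →
  ∀ {t} → Irreducible (C t) → Irreducible t
irreducible-inside congruence irr t' t⟶t' = irr _ (congruence t⟶t')

canonical-∥ : ∀ A {t u} → Irreducible (t ∥ u) →
  Canonical A t → Canonical A u → Canonical A (t ∥ u)
canonical-∥ ⊤ᶠ      irr refl           refl           = ⊥-elim (irr _ ∥idem)
canonical-∥ ⊥ᶠ      irr ()
canonical-∥ (A ⇒ B) irr (_ , refl)     (_ , refl)     = ⊥-elim (irr _ ∥lam)
canonical-∥ (A ∧ B) irr (_ , _ , refl) (_ , _ , refl) = ⊥-elim (irr _ ∥pair)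
canonical-∥ (A ∨ B) irr _              _              = inj₂ (inj₂ (_ , _ , refl))
canonical-∥ (A ⊙ B) irr (_ , _ , refl) (_ , _ , refl) = ⊥-elim (irr _ ∥plus)

irreducible⇒canonical : ∀ {t A} → Irreducible t → [] ⊢ t ∶ A → Canonical A t
irreducible⇒canonical irr (ty-var {()} _)
irreducible⇒canonical {A = A} irr (ty-par ⊢t ⊢u) =
  canonical-∥ A irr
    (irreducible⇒canonical (irreducible-inside c-∥₁ irr) ⊢t)
    (irreducible⇒canonical (irreducible-inside c-∥₂ irr) ⊢u)
irreducible⇒canonical irr ty-star = refl
irreducible⇒canonical irr (ty-δ⊥ ⊢t) =
  ⊥-elim (irreducible⇒canonical (irreducible-inside c-δ⊥ irr) ⊢t)
irreducible⇒canonical irr (ty-lam _) = _ , refl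
irreducible⇒canonical irr (ty-app ⊢t _)
  with irreducible⇒canonical (irreducible-inside c-app₁ irr) ⊢t
... | _ , refl = ⊥-elim (irr _ β⇒)
irreducible⇒canonical irr (ty-pair _ _) = _ , _ , refl
irreducible⇒canonical irr (ty-δ∧ ⊢t _)
  with irreducible⇒canonical (irreducible-inside c-δ∧₁ irr) ⊢t
... | _ , _ , refl = ⊥-elim (irr _ β∧)
irreducible⇒canonical irr (ty-inl _) = inj₁ (_ , refl)
irreducible⇒canonical irr (ty-inr _) = inj₂ (inj₁ (_ , refl))
irreducible⇒canonical irr (ty-δ∨ ⊢t _ _)
  with irreducible⇒canonical (irreducible-inside c-δ∨₁ irr) ⊢t
... | inj₁ (_ , refl)            = ⊥-elim (irr _ β∨l)
... | inj₂ (inj₁ (_ , refl))     = ⊥-elim (irr _ β∨r)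
... | inj₂ (inj₂ (_ , _ , refl)) = ⊥-elim (irr _ δ∨∥)
irreducible⇒canonical irr (ty-plus _ _) = _ , _ , refl
irreducible⇒canonical irr (ty-δ⊙ ⊢t _ _)
  with irreducible⇒canonical (irreducible-inside c-δ⊙₁ irr) ⊢t
... | _ , _ , refl = ⊥-elim (irr _ β⊙l)
irreducible⇒canonical irr (ty-δ⊙∥ ⊢t _ _)
  with irreducible⇒canonical (irreducible-inside c-δ⊙∥₁ irr) ⊢t
... | _ , _ , refl = ⊥-elim (irr _ β⊙∥)

mainTheorem2 : (t : Closed) (A : Form) → Irreducible t → [] ⊢ t ∶ A →
      (A ≡ ⊤ᶠ → t ≡ star)
    × (A ≢ ⊥ᶠ)
    × (∀ B C → A ≡ B ⇒ C → ∃[ u ] t ≡ lam u)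
    × (∀ B C → A ≡ B ∧ C → ∃[ u ] ∃[ v ] t ≡ pair u v)
    × (∀ B C → A ≡ B ∨ C →
         (∃[ u ] t ≡ inl u) ⊎ (∃[ u ] t ≡ inr u) ⊎ (∃[ u ] ∃[ v ] t ≡ u ∥ v))
    × (∀ B C → A ≡ B ⊙ C → ∃[ u ] ∃[ v ] t ≡ plus u v)
mainTheorem2 t A irr ⊢t =
    (λ { refl → canonical })
  , (λ { refl → canonical })
  , (λ { _ _ refl → canonical })
  , (λ { _ _ refl → canonical })
  , (λ { _ _ refl → canonical })
  , (λ { _ _ refl → canonical })
  where
  canonical : Canonical A t
  canonical = irreducible⇒canonical irr ⊢t
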